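{- Let $\lambda$ be a circular composition different from $(1,1)$. Then $\lambda$ has a unique parent in the tree of circular compositions, i.e. there is exactly one composition $\mu$ such that $\lambda$ is a child (of type 1 or type 2) of $\mu$.
   Context: A composition of $n$ is a finite sequence $(\lambda_1,\dots,\lambda_r)$ of positive integers with sum $n$. For $\llbracket a,b\rrbracket=[a,b]\cap\mathbb{Z}$, define $B_i=\llbracket 1+\sum_{j<i}\lambda_j,\ \sum_{j\le i}\lambda_j\rrbracket$ and $s_i=\sum_{j>i}\lambda_j-\sum_{j<i}\lambda_j$. The symmetric discrete interval exchange $T_\lambda$ is the permutation of $\llbracket 1,n\rrbracket$ given by $T_\lambda(x)=x+s_i$ for $x\in B_i$. A composition $\lambda$ is circular if $T_\lambda$ has exactly one orbit. For a composition $\lambda=(\lambda_1,\dots,\lambda_r)$ of $n$ and $t\in\{0,\dots,r\}$ put $\delta_t=n-2\sum_{j\le t}\lambda_j$, with the convention $\lambda_0=\lambda_{r+1}=0$. The children of $\lambda$ are: (Type 1) $(\lambda_1,\dots,\lambda_{t-1},\lambda_t+|s_t|,\lambda_{t+1},\dots,\lambda_r)$ for each $t\in\{1,\dots,r\}$; (Type 2) $(\lambda_1,\dots,\lambda_t,|\delta_t|,\lambda_{t+1},\dots,\lambda_r)$ for each $t\in\{0,\dots,r\}$ such that $\delta_t>\lambda_{t+1}$ or $-\delta_t>\lambda_t$. The tree of circular compositions is the infinite rooted tree with root $(1,1)$ in which the children of each vertex labelled $\lambda$ are vertices labelled by the children of $\lambda$. -}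

module Defs where

open import Data.Nat as ℕ using (ℕ; zero; suc)
open import Data.Integer as ℤ using (ℤ; +_; _+_; _-_; -_; ∣_∣; _<_; _≤_)
open import Data.List using (List; []; _∷_; _++_)
open import Data.Nat.ListAction using (sum)
open import Data.List.Relation.Unary.All using (All)
open import Data.Product using (Σ; ∃; _×_; _,_)
open import Data.Sum using (_⊎_)
open import Data.Bool using (if_then_else_; _∧_)
open import Relation.Nullary.Decidable using (⌊_⌋)
open import Relation.Binary.PropositionalEquality using (_≡_)

IsComposition : List ℕ → Set
IsComposition = All (λ a → 0 ℕ.< a)

-- T_λ, extended by the identity outside ⟦1,n⟧.  `go pre μ x`: `pre` is the sum
-- of the parts already passed; for x ∈ B_i = ⟦pre+1, pre+λ_i⟧ we return
-- x + s_i with s_i = (sum of later parts) - pre.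
private
  go : ℕ → List ℕ → ℤ → ℤ
  go pre [] x = x
  go pre (a ∷ rest) x =
    if ⌊ (+ pre) ℤ.<? x ⌋ ∧ ⌊ x ℤ.≤? + (pre ℕ.+ a) ⌋
    then x + (+ sum rest - + pre)
    else go (pre ℕ.+ a) rest x

T : List ℕ → ℤ → ℤ
T λ' x = go 0 λ' x

iter : (ℤ → ℤ) → ℕ → ℤ → ℤ
iter f zero x = x
iter f (suc k) x = f (iter f k x)

InRange : ℕ → ℤ → Set
InRange n x = (+ 1 ≤ x) × (x ≤ + n)

Circular : List ℕ → Set
Circular λ' = (1 ℕ.≤ sum λ') ×
  (∀ x y → InRange (sum λ') x → InRange (sum λ') y → ∃ λ k → iter (T λ') k x ≡ y)

headOr0 : List ℕ → ℕ
headOr0 [] = 0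
headOr0 (a ∷ _) = a

lastOr0 : List ℕ → ℕ
lastOr0 [] = 0
lastOr0 (a ∷ []) = a
lastOr0 (_ ∷ b ∷ xs) = lastOr0 (b ∷ xs)

-- Type 1 child: μ = xs ++ a ∷ ys (a = μ_t), s_t = sum ys - sum xs,
-- child = xs ++ (a + |s_t|) ∷ ys.
ChildType1 : List ℕ → List ℕ → Set
ChildType1 μ λ' = Σ (List ℕ) λ xs → Σ ℕ λ a → Σ (List ℕ) λ ys →
  (μ ≡ xs ++ a ∷ ys) ×
  (λ' ≡ xs ++ (a ℕ.+ ∣ + sum ys - + sum xs ∣) ∷ ys)

-- Type 2 child: μ = xs ++ ys with t = length xs, δ_t = n - 2 sum xs
-- = sum ys - sum xs; λ_t = lastOr0 xs, λ_{t+1} = headOr0 ys;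
-- condition δ_t > λ_{t+1} or -δ_t > λ_t; child = xs ++ |δ_t| ∷ ys.
ChildType2 : List ℕ → List ℕ → Set
ChildType2 μ λ' = Σ (List ℕ) λ xs → Σ (List ℕ) λ ys →
  (μ ≡ xs ++ ys) ×
  ((+ headOr0 ys < + sum ys - + sum xs) ⊎ (+ lastOr0 xs < - (+ sum ys - + sum xs))) ×
  (λ' ≡ xs ++ ∣ + sum ys - + sum xs ∣ ∷ ys)

IsChild : List ℕ → List ℕ → Set
IsChild μ λ' = ChildType1 μ λ' ⊎ ChildType2 μ λ'

-- A composition λ of n has a midpoint n/2 (in doubled coordinates, the natural number n).
-- Every child puts its new material exactly there: the enlarged part of a type-1 child
-- contains the midpoint in its interior, and the part inserted by a type-2 child ends or
-- starts at it. So if the midpoint of λ is interior to a part b, the only candidate parent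
-- shrinks b by |Σ after − Σ before|, and it is one. If instead the midpoint separates
-- parts b and c, the only candidate deletes the larger of b and c; b = c cannot happen,
-- since then T_λ swaps the first points of these two blocks, and a 2-cycle contradicts
-- circularity unless λ = (1,1).
module Submission where

open import Defs
open import Data.Nat using (ℕ; zero; suc; z≤n; s≤s; _+_; _*_; _∸_; _≤_; _<_)
import Data.Nat.Properties as ℕₚ
open import Data.Nat.Tactic.RingSolver using (solve-∀)
open import Data.Integer as ℤ using (ℤ; +_; -_; +≤+; +<+)
import Data.Integer.Properties as ℤₚ
import Data.Integer.Tactic.RingSolver as ℤ-Solver
open import Data.List using (List; []; _∷_; _++_; _∷ʳ_)
open import Data.List.Properties using (∷-injective; ∷ʳ-injective; ∷ʳ-++; ++-identityʳ)
open import Data.Nat.ListAction using (sum)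
open import Data.Nat.ListAction.Properties using (sum-++)
open import Data.List.Relation.Unary.All using ([]; _∷_; head; tail)
open import Data.List.Relation.Unary.All.Properties using (++⁺; ++⁻ˡ; ++⁻ʳ)
open import Data.Product using (Σ; ∃-syntax; _×_; _,_; proj₁; proj₂)
open import Data.Sum using (_⊎_; inj₁; inj₂; [_,_])
open import Data.Empty using (⊥-elim)
open import Relation.Nullary using (¬_; yes; no)
open import Relation.Binary using (tri<; tri≈; tri>)
open import Relation.Binary.PropositionalEquality
  using (_≡_; _≢_; refl; sym; trans; cong; subst; subst₂; module ≡-Reasoning)

private
  variable
    h l m n d a b c : ℕ
    xs ys ws xs′ ys′ ν : List ℕ

2*n≡n+n : ∀ n → 2 * n ≡ n + n
2*n≡n+n = solve-∀

-- |s_t| and |δ_t| in the paper, with m and n the sums before and after the cut.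
gap : ℕ → ℕ → ℕ
gap m n = ℤ.∣ + n ℤ.- + m ∣

+n-+m≡+d : m + d ≡ n → + n ℤ.- + m ≡ + d
+n-+m≡+d {m} {d} refl = trans (cong (ℤ._- + m) (ℤₚ.pos-+ m d)) (cancel (+ m) (+ d))
  where
  cancel : ∀ i j → i ℤ.+ j ℤ.- i ≡ j
  cancel = ℤ-Solver.solve-∀

+n-+m≡-+d : n + d ≡ m → + n ℤ.- + m ≡ - + d
+n-+m≡-+d {n} {d} refl = trans (cong (λ i → + n ℤ.- i) (ℤₚ.pos-+ n d)) (cancel (+ n) (+ d))
  where
  cancel : ∀ i j → i ℤ.- (i ℤ.+ j) ≡ - j
  cancel = ℤ-Solver.solve-∀

data Difference (m n : ℕ) : Set where
  ascending  : m + gap m n ≡ n → + n ℤ.- + m ≡ + gap m n → Difference m n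
  descending : n + gap m n ≡ m → + n ℤ.- + m ≡ - + gap m n → Difference m n

difference : ∀ m n → Difference m n
difference m n with ℕₚ.≤-total m n
... | inj₁ m≤n with d , refl ← ℕₚ.m≤n⇒∃[o]m+o≡n m≤n =
  ascending (cong (λ k → m + k) gap≡d) (trans eq (cong +_ (sym gap≡d)))
  where
  eq = +n-+m≡+d {m} {d} refl
  gap≡d = cong ℤ.∣_∣ eq
... | inj₂ n≤m with d , refl ← ℕₚ.m≤n⇒∃[o]m+o≡n n≤m =
  descending (cong (λ k → n + k) gap≡d) (trans eq (cong (λ k → - + k) (sym gap≡d)))
  where
  eq = +n-+m≡-+d {n} {d} refl
  gap≡d = trans (cong ℤ.∣_∣ eq) (ℤₚ.∣-i∣≡∣i∣ (+ d))

right-condition⇒ : + h ℤ.< + n ℤ.- + m → m + gap m n ≡ n × h < gap m n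
right-condition⇒ {h} {n} {m} h< with difference m n
... | ascending up eq = up , ℤₚ.drop‿+<+ (subst (+ h ℤ.<_) eq h<)
... | descending _ eq = ⊥-elim (ℤₚ.<⇒≱ (subst (+ h ℤ.<_) eq h<) ℤₚ.neg-≤-pos)

left-condition⇒ : + l ℤ.< - (+ n ℤ.- + m) → n + gap m n ≡ m × l < gap m n
left-condition⇒ {l} {n} {m} l< with difference m n
... | ascending _ eq = ⊥-elim (ℤₚ.<⇒≱ (subst (λ i → + l ℤ.< - i) eq l<) ℤₚ.neg-≤-pos)
... | descending down eq =
  down , ℤₚ.drop‿+<+ (subst (+ l ℤ.<_) (trans (cong -_ eq) (ℤₚ.neg-involutive _)) l<)

⇒right-condition : m + d ≡ n → h < d → + h ℤ.< + n ℤ.- + m × gap m n ≡ d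
⇒right-condition e h<d = subst (+ _ ℤ.<_) (sym eq) (+<+ h<d) , cong ℤ.∣_∣ eq
  where eq = +n-+m≡+d e

⇒left-condition : n + d ≡ m → l < d → + l ℤ.< - (+ n ℤ.- + m) × gap m n ≡ d
⇒left-condition {d = d} e l<d =
  subst (+ _ ℤ.<_) (sym (trans (cong -_ eq) (ℤₚ.neg-involutive (+ d)))) (+<+ l<d) ,
  trans (cong ℤ.∣_∣ eq) (ℤₚ.∣-i∣≡∣i∣ (+ d))
  where eq = +n-+m≡-+d e

Central : ℕ → ℕ → ℕ → Set
Central m b n = m < b + n × n < m + b

gap<⇒central : gap m n < b → Central m b n
gap<⇒central {m} {n} {b} g<b with difference m n
... | ascending up _ = subst (Central m b) up
  ( ℕₚ.<-≤-trans (ℕₚ.m<n+m m 0<b) (ℕₚ.+-monoʳ-≤ b (ℕₚ.m≤m+n m (gap m n)))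
  , ℕₚ.+-monoʳ-< m g<b )
  where 0<b = ℕₚ.≤-<-trans z≤n g<b
... | descending down _ = subst (λ k → Central k b n) down
  ( subst (n + gap m n <_) (ℕₚ.+-comm n b) (ℕₚ.+-monoʳ-< n g<b)
  , ℕₚ.≤-<-trans (ℕₚ.m≤m+n n (gap m n)) (ℕₚ.m<m+n (n + gap m n) 0<b) )
  where 0<b = ℕₚ.≤-<-trans z≤n g<b

central⇒gap< : Central m b n → gap m n < b
central⇒gap< {m} {b} {n} (m<b+n , n<m+b) with difference m n
... | ascending up _ = ℕₚ.+-cancelˡ-< m (gap m n) b (subst (_< m + b) (sym up) n<m+b)
... | descending down _ = ℕₚ.+-cancelˡ-< n (gap m n) b
  (subst₂ _<_ (sym down) (ℕₚ.+-comm b n) m<b+n)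

++-equidivisible : ∀ {A : Set} (xs us ys vs : List A) → xs ++ us ≡ ys ++ vs →
  (∃[ ws ] ys ≡ xs ++ ws × us ≡ ws ++ vs) ⊎ (∃[ ws ] xs ≡ ys ++ ws × vs ≡ ws ++ us)
++-equidivisible []       us ys       vs eq = inj₁ (ys , refl , eq)
++-equidivisible (x ∷ xs) us []       vs eq = inj₂ (x ∷ xs , refl , sym eq)
++-equidivisible (x ∷ xs) us (y ∷ ys) vs eq with refl , eq′ ← ∷-injective eq
  with ++-equidivisible xs us ys vs eq′
... | inj₁ (ws , p , q) = inj₁ (ws , cong (x ∷_) p , q)
... | inj₂ (ws , p , q) = inj₂ (ws , cong (x ∷_) p , q)

sum-∷ʳ : ∀ xs b → sum (xs ∷ʳ b) ≡ sum xs + b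
sum-∷ʳ xs b = trans (sum-++ xs (b ∷ [])) (cong (λ k → sum xs + k) (ℕₚ.+-identityʳ b))

sum+b≤sum-++-∷ : ∀ xs b ys → sum xs + b ≤ sum (xs ++ b ∷ ys)
sum+b≤sum-++-∷ xs b ys =
  subst (sum xs + b ≤_) (trans (ℕₚ.+-assoc (sum xs) b (sum ys)) (sym (sum-++ xs (b ∷ ys))))
    (ℕₚ.m≤m+n (sum xs + b) (sum ys))

sum≤sum-++ : ∀ xs ys → sum xs ≤ sum (xs ++ ys)
sum≤sum-++ xs ys = subst (sum xs ≤_) (sym (sum-++ xs ys)) (ℕₚ.m≤m+n (sum xs) (sum ys))

lastOr0-∷ʳ : ∀ xs b → lastOr0 (xs ∷ʳ b) ≡ b
lastOr0-∷ʳ []           b = refl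
lastOr0-∷ʳ (x ∷ [])     b = refl
lastOr0-∷ʳ (x ∷ y ∷ xs) b = lastOr0-∷ʳ (y ∷ xs) b

part-positive : IsComposition (xs ++ b ∷ ys) → 0 < b
part-positive {xs} c = head (++⁻ʳ xs c)

sum≡0⇒[] : IsComposition xs → sum xs ≡ 0 → xs ≡ []
sum≡0⇒[] []                     _  = refl
sum≡0⇒[] {suc _ ∷ _} (_ ∷ _)    ()

-- The midpoint

-- m is a doubled coordinate: the point m/2 lies strictly inside the part b after xs.
record Straddles (m : ℕ) (xs : List ℕ) (b : ℕ) : Set where
  constructor straddles
  field
    below : 2 * sum xs < m
    above : m < 2 * (sum xs + b)

straddles-below : Straddles m xs b → n ≤ sum xs → 2 * n < m
straddles-below (straddles p _) n≤ = ℕₚ.≤-<-trans (ℕₚ.*-monoʳ-≤ 2 n≤) p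

straddles-above : Straddles m xs b → sum xs + b ≤ n → m < 2 * n
straddles-above (straddles _ q) ≤n = ℕₚ.<-≤-trans q (ℕₚ.*-monoʳ-≤ 2 ≤n)

straddles-extension⇒[] : xs′ ≡ xs ++ ws → b ∷ ys ≡ ws ++ a ∷ ys′ →
  Straddles m xs b → Straddles m xs′ a → ws ≡ []
straddles-extension⇒[] {ws = []} _ _ _ _ = refl
straddles-extension⇒[] {xs = xs} {ws = w ∷ ws} refl eq S S′ with refl , _ ← ∷-injective eq =
  ⊥-elim (ℕₚ.<-asym (Straddles.below S′) (straddles-above S (sum+b≤sum-++-∷ xs w ws)))

straddles-unique : xs ++ b ∷ ys ≡ xs′ ++ a ∷ ys′ → Straddles m xs b → Straddles m xs′ a →
  xs ≡ xs′ × b ≡ a × ys ≡ ys′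
straddles-unique {xs} {b} {ys} {xs′} {a} {ys′} eq S S′
  with ++-equidivisible xs (b ∷ ys) xs′ (a ∷ ys′) eq
... | inj₁ (ws , p , q)
  with refl ← straddles-extension⇒[] p q S S′ with refl , refl ← ∷-injective q =
  sym (trans p (++-identityʳ xs)) , refl , refl
... | inj₂ (ws , p , q)
  with refl ← straddles-extension⇒[] p q S′ S with refl , refl ← ∷-injective q =
  trans p (++-identityʳ xs′) , refl , refl

straddles-half-disjoint : ∀ zs ws → xs ++ b ∷ ys ≡ zs ++ ws → Straddles m xs b → 2 * sum zs ≢ m
straddles-half-disjoint {xs} {b} {ys} zs ws eq S half
  with ++-equidivisible xs (b ∷ ys) zs ws eq
... | inj₁ ([] , refl , _) =
  ℕₚ.<-irrefl half (straddles-below S (ℕₚ.≤-reflexive (cong sum (++-identityʳ xs))))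
... | inj₁ (u ∷ us , refl , q) with refl , _ ← ∷-injective q =
  ℕₚ.<-irrefl (sym half) (straddles-above S (sum+b≤sum-++-∷ xs b us))
... | inj₂ (us , refl , _) = ℕₚ.<-irrefl half (straddles-below S (sum≤sum-++ zs us))

sum-++≡sum⇒[] : ∀ zs → IsComposition ws → sum (zs ++ ws) ≡ sum zs → ws ≡ []
sum-++≡sum⇒[] {ws} zs c e = sum≡0⇒[] c (ℕₚ.+-cancelˡ-≡ (sum zs) (sum ws) 0
  (trans (sym (sum-++ zs ws)) (trans e (sym (ℕₚ.+-identityʳ (sum zs))))))

halves-unique : ∀ zs ws zs′ ws′ → IsComposition (zs ++ ws) → zs ++ ws ≡ zs′ ++ ws′ →
  2 * sum zs ≡ m → 2 * sum zs′ ≡ m → zs ≡ zs′ × ws ≡ ws′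
halves-unique zs ws zs′ ws′ c eq half half′
  with ++-equidivisible zs ws zs′ ws′ eq
... | inj₁ (us , refl , q)
  with refl ← sum-++≡sum⇒[] zs (++⁻ˡ us (subst IsComposition q (++⁻ʳ zs c)))
                (ℕₚ.*-cancelˡ-≡ (sum (zs ++ us)) (sum zs) 2 (trans half′ (sym half)))
  = sym (++-identityʳ zs) , q
... | inj₂ (us , refl , q)
  with refl ← sum-++≡sum⇒[] zs′ (++⁻ʳ zs′ (++⁻ˡ (zs′ ++ us) c))
                (ℕₚ.*-cancelˡ-≡ (sum (zs′ ++ us)) (sum zs′) 2 (trans half (sym half′)))
  = ++-identityʳ zs′ , sym q

straddles-∷ : Straddles m xs b → Straddles (2 * a + m) (a ∷ xs) b
straddles-∷ {m} {xs} {b} {a} (straddles p q) = straddles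
  (subst (_< 2 * a + m) (sym (ℕₚ.*-distribˡ-+ 2 a (sum xs))) (ℕₚ.+-monoʳ-< (2 * a) p))
  (subst (2 * a + m <_) (shift a (sum xs) b) (ℕₚ.+-monoʳ-< (2 * a) q))
  where
  shift : ∀ a x b → 2 * a + 2 * (x + b) ≡ 2 * (a + x + b)
  shift = solve-∀

locate : ∀ L m → 0 < m → m < 2 * sum L →
  (∃[ xs ] ∃[ b ] ∃[ ys ] L ≡ xs ++ b ∷ ys × Straddles m xs b) ⊎
  (∃[ xs ] ∃[ b ] ∃[ c ] ∃[ ys ] L ≡ xs ++ b ∷ c ∷ ys × 2 * (sum xs + b) ≡ m)
locate []      m _   m<0 = ⊥-elim (ℕₚ.n≮0 m<0)
locate (a ∷ L) m 0<m m< with ℕₚ.<-cmp m (2 * a)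
... | tri< m<2a _ _ = inj₁ ([] , a , L , refl , straddles 0<m m<2a)
locate (a ∷ [])     m 0<m m< | tri≈ _ refl _ =
  ⊥-elim (ℕₚ.<-irrefl (cong (2 *_) (sym (ℕₚ.+-identityʳ a))) m<)
locate (a ∷ c ∷ L) m 0<m m< | tri≈ _ refl _ = inj₂ ([] , a , c , L , refl , refl)
locate (a ∷ L) m 0<m m< | tri> _ _ 2a<m with ℕₚ.m≤n⇒∃[o]m+o≡n (ℕₚ.<⇒≤ 2a<m)
... | zero , refl = ⊥-elim (ℕₚ.<-irrefl (sym (ℕₚ.+-identityʳ (2 * a))) 2a<m)
... | suc k , refl
  with locate L (suc k) (s≤s z≤n)
         (ℕₚ.+-cancelˡ-< (2 * a) (suc k) (2 * sum L)
           (subst (2 * a + suc k <_) (ℕₚ.*-distribˡ-+ 2 a (sum L)) m<))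
... | inj₁ (xs , b , ys , refl , S) = inj₁ (a ∷ xs , b , ys , refl , straddles-∷ S)
... | inj₂ (xs , b , c , ys , refl , half) =
  inj₂ (a ∷ xs , b , c , ys , refl , trans (shift a (sum xs) b) (cong (λ k → 2 * a + k) half))
  where
  shift : ∀ a x b → 2 * (a + x + b) ≡ 2 * a + 2 * (x + b)
  shift = solve-∀

central⇒straddles : Central (sum xs) b (sum ys) → Straddles (sum (xs ++ b ∷ ys)) xs b
central⇒straddles {xs} {b} {ys} (x< , y<) rewrite sum-++ xs (b ∷ ys) = straddles
  (begin-strict
    2 * X        ≡⟨ 2*n≡n+n X ⟩
    X + X        <⟨ ℕₚ.+-monoʳ-< X x< ⟩
    X + (b + Y)  ∎)
  (begin-strict
    X + (b + Y)        ≡⟨ ℕₚ.+-assoc X b Y ⟨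
    X + b + Y          <⟨ ℕₚ.+-monoʳ-< (X + b) y< ⟩
    X + b + (X + b)    ≡⟨ 2*n≡n+n (X + b) ⟨
    2 * (X + b)        ∎)
  where
  open ℕₚ.≤-Reasoning
  X = sum xs
  Y = sum ys

straddles⇒central : Straddles (sum (xs ++ b ∷ ys)) xs b → Central (sum xs) b (sum ys)
straddles⇒central {xs} {b} {ys} (straddles p q) =
  ℕₚ.+-cancelˡ-< X X (b + Y) (subst₂ _<_ (2*n≡n+n X) (sum-++ xs (b ∷ ys)) p) ,
  ℕₚ.+-cancelˡ-< (X + b) Y (X + b)
    (subst₂ _<_ (trans (sum-++ xs (b ∷ ys)) (sym (ℕₚ.+-assoc X b Y))) (2*n≡n+n (X + b)) q)
  where
  X = sum xs
  Y = sum ys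

half-after : ∀ xs d ys → sum xs + d ≡ sum ys → 2 * sum (xs ∷ʳ d) ≡ sum (xs ++ d ∷ ys)
half-after xs d ys e = begin
  2 * sum (xs ∷ʳ d)          ≡⟨ cong (2 *_) (sum-∷ʳ xs d) ⟩
  2 * (sum xs + d)           ≡⟨ 2*n≡n+n (sum xs + d) ⟩
  sum xs + d + (sum xs + d)  ≡⟨ cong (λ k → sum xs + d + k) e ⟩
  sum xs + d + sum ys        ≡⟨ ℕₚ.+-assoc (sum xs) d (sum ys) ⟩
  sum xs + (d + sum ys)      ≡⟨ sum-++ xs (d ∷ ys) ⟨
  sum (xs ++ d ∷ ys)         ∎
  where open ≡-Reasoning

half-before : ∀ xs d ys → sum ys + d ≡ sum xs → 2 * sum xs ≡ sum (xs ++ d ∷ ys)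
half-before xs d ys e = begin
  2 * sum xs               ≡⟨ 2*n≡n+n (sum xs) ⟩
  sum xs + sum xs          ≡⟨ cong (λ k → sum xs + k) (trans (sym e) (ℕₚ.+-comm (sum ys) d)) ⟩
  sum xs + (d + sum ys)    ≡⟨ sum-++ xs (d ∷ ys) ⟨
  sum (xs ++ d ∷ ys)       ∎
  where open ≡-Reasoning

type1-straddles : ∀ {L} xs a ys → IsComposition (xs ++ a ∷ ys) →
  let b = a + gap (sum xs) (sum ys) in L ≡ xs ++ b ∷ ys → Straddles (sum L) xs b
type1-straddles xs a ys c refl =
  central⇒straddles (gap<⇒central (ℕₚ.m<n+m _ (part-positive {xs = xs} c)))

childType2-view : ∀ {μ L} → ChildType2 μ L →
  (∃[ xs ] ∃[ d ] ∃[ ys ]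
     μ ≡ xs ++ ys × L ≡ (xs ∷ʳ d) ++ ys × headOr0 ys < d × 2 * sum (xs ∷ʳ d) ≡ sum L) ⊎
  (∃[ xs ] ∃[ d ] ∃[ ys ]
     μ ≡ xs ++ ys × L ≡ xs ++ d ∷ ys × lastOr0 xs < d × 2 * sum xs ≡ sum L)
childType2-view (xs , ys , refl , inj₁ cond , refl)
  with up , h<g ← right-condition⇒ {m = sum xs} cond =
  inj₁ (xs , _ , ys , refl , sym (∷ʳ-++ xs _ ys) , h<g , half-after xs _ ys up)
childType2-view (xs , ys , refl , inj₂ cond , refl)
  with down , l<g ← left-condition⇒ {m = sum xs} cond =
  inj₂ (xs , _ , ys , refl , refl , l<g , half-before xs _ ys down)

straddling-parent : IsComposition (xs ++ b ∷ ys) → Straddles (sum (xs ++ b ∷ ys)) xs b →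
  let μ = xs ++ (b ∸ gap (sum xs) (sum ys)) ∷ ys in IsComposition μ × IsChild μ (xs ++ b ∷ ys)
straddling-parent {xs} {b} {ys} c S =
  ++⁺ (++⁻ˡ xs c) (ℕₚ.m<n⇒0<n∸m g<b ∷ tail (++⁻ʳ xs c)) ,
  inj₁ (xs , b ∸ g , ys , refl , cong (λ k → xs ++ k ∷ ys) (sym (ℕₚ.m∸n+n≡m (ℕₚ.<⇒≤ g<b))))
  where
  g = gap (sum xs) (sum ys)
  g<b = central⇒gap< (straddles⇒central S)

straddling-parent-unique : IsComposition ν → IsChild ν (xs ++ b ∷ ys) →
  Straddles (sum (xs ++ b ∷ ys)) xs b → ν ≡ xs ++ (b ∸ gap (sum xs) (sum ys)) ∷ ys
straddling-parent-unique {xs = xs} {ys = ys} cν (inj₁ (xs′ , a , ys′ , refl , eq)) S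
  with refl , refl , refl ← straddles-unique eq S (type1-straddles xs′ a ys′ cν eq)
  = cong (λ k → xs ++ k ∷ ys) (sym (ℕₚ.m+n∸n≡m a (gap (sum xs) (sum ys))))
straddling-parent-unique cν (inj₂ t) S with childType2-view t
... | inj₁ (xs′ , d , ys′ , _ , eq , _ , half) =
  ⊥-elim (straddles-half-disjoint (xs′ ∷ʳ d) ys′ eq S half)
... | inj₂ (xs′ , d , ys′ , _ , eq , _ , half) =
  ⊥-elim (straddles-half-disjoint xs′ (d ∷ ys′) eq S half)

balanced-parent-right : sum xs + b ≡ c + sum ys → c < b →
  ChildType2 (xs ++ c ∷ ys) (xs ++ b ∷ c ∷ ys)
balanced-parent-right {xs} {b} {c} {ys} bal c<b
  with cond , g≡b ← ⇒right-condition {h = c} bal c<b =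
  xs , c ∷ ys , refl , inj₁ cond , cong (λ k → xs ++ k ∷ c ∷ ys) (sym g≡b)

balanced-parent-left : sum xs + b ≡ c + sum ys → b < c →
  ChildType2 (xs ++ b ∷ ys) (xs ++ b ∷ c ∷ ys)
balanced-parent-left {xs} {b} {c} {ys} bal b<c =
  xs ∷ʳ b , ys , sym (∷ʳ-++ xs b ys) ,
  inj₂ (subst (λ k → + k ℤ.< - (+ sum ys ℤ.- + sum (xs ∷ʳ b))) (sym (lastOr0-∷ʳ xs b))
          (proj₁ gap-condition)) ,
  trans (sym (∷ʳ-++ xs b (c ∷ ys)))
        (cong (λ k → (xs ∷ʳ b) ++ k ∷ ys) (sym (proj₂ gap-condition)))
  where
  gap-condition : + b ℤ.< - (+ sum ys ℤ.- + sum (xs ∷ʳ b)) × gap (sum (xs ∷ʳ b)) (sum ys) ≡ c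
  gap-condition = ⇒left-condition
    (trans (ℕₚ.+-comm (sum ys) c) (trans (sym bal) (sym (sum-∷ʳ xs b)))) b<c

balanced-parent-unique : IsComposition (xs ++ b ∷ c ∷ ys) → sum xs + b ≡ c + sum ys →
  IsComposition ν → IsChild ν (xs ++ b ∷ c ∷ ys) →
  (ν ≡ xs ++ c ∷ ys × c < b) ⊎ (ν ≡ xs ++ b ∷ ys × b < c)
balanced-parent-unique {xs} {b} {c} {ys} _ bal cν (inj₁ (xs′ , a , ys′ , refl , eq)) =
  ⊥-elim (straddles-half-disjoint (xs ∷ʳ b) (c ∷ ys)
    (trans (sym eq) (sym (∷ʳ-++ xs b (c ∷ ys)))) (type1-straddles xs′ a ys′ cν eq)
    (half-after xs b (c ∷ ys) bal))
balanced-parent-unique {xs} {b} {c} {ys} cL bal _ (inj₂ t) with childType2-view t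
... | inj₁ (xs′ , d , ys′ , refl , eq , hd<d , half′)
  with p , refl ← halves-unique (xs ∷ʳ b) (c ∷ ys) (xs′ ∷ʳ d) ys′
                    (subst IsComposition (sym (∷ʳ-++ xs b (c ∷ ys))) cL)
                    (trans (∷ʳ-++ xs b (c ∷ ys)) eq) (half-after xs b (c ∷ ys) bal) half′
  with refl , refl ← ∷ʳ-injective xs xs′ p = inj₁ (refl , hd<d)
... | inj₂ (xs′ , d , ys′ , refl , eq , last<d , half′)
  with refl , q ← halves-unique (xs ∷ʳ b) (c ∷ ys) xs′ (d ∷ ys′)
                    (subst IsComposition (sym (∷ʳ-++ xs b (c ∷ ys))) cL)
                    (trans (∷ʳ-++ xs b (c ∷ ys)) eq) (half-after xs b (c ∷ ys) bal) half′
  with refl , refl ← ∷-injective q =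
  inj₂ (∷ʳ-++ xs b ys , subst (_< c) (lastOr0-∷ʳ xs b) last<d)

-- The interval exchange

-- The loop behind T is private to Defs; for x > p, `T (p ∷ L) x` runs that loop on L
-- from offset p, which is how a block in the middle of a composition is reached.
T-cons-zero : ∀ L x → + 0 ℤ.< x → T L x ≡ T (0 ∷ L) x
T-cons-zero L x 0<x with + 0 ℤ.<? x | x ℤ.≤? + 0
... | yes _ | no _    = refl
... | no ¬p | _       = ⊥-elim (¬p 0<x)
... | yes _ | yes x≤0 = ⊥-elim (ℤₚ.<⇒≱ 0<x x≤0)

T-skip : ∀ p a L x → + (p + a) ℤ.< x → T (p ∷ a ∷ L) x ≡ T ((p + a) ∷ L) x
T-skip p a L x p+a<x with + 0 ℤ.<? x | x ℤ.≤? + p | + p ℤ.<? x | x ℤ.≤? + (p + a)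
... | yes _ | no _    | yes _ | no _ = refl
... | no ¬q | _       | _     | _    = ⊥-elim (¬q (ℤₚ.≤-<-trans (+≤+ z≤n) p+a<x))
... | yes _ | yes x≤p | _     | _    = ⊥-elim (ℤₚ.<⇒≱ (ℤₚ.≤-<-trans (+≤+ p≤p+a) p+a<x) x≤p)
  where p≤p+a = ℕₚ.m≤m+n p a
... | yes _ | no _    | no ¬q | _    = ⊥-elim (¬q (ℤₚ.≤-<-trans (+≤+ (ℕₚ.m≤m+n p a)) p+a<x))
... | yes _ | no _    | yes _ | yes x≤ = ⊥-elim (ℤₚ.<⇒≱ p+a<x x≤)

T-hit : ∀ p a L x → + p ℤ.< x → x ℤ.≤ + (p + a) → T (p ∷ a ∷ L) x ≡ x ℤ.+ (+ sum L ℤ.- + p)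
T-hit p a L x p<x x≤ with + 0 ℤ.<? x | x ℤ.≤? + p | + p ℤ.<? x | x ℤ.≤? + (p + a)
... | yes _ | no _    | yes _ | yes _ = refl
... | no ¬q | _       | _     | _     = ⊥-elim (¬q (ℤₚ.≤-<-trans (+≤+ z≤n) p<x))
... | yes _ | yes x≤p | _     | _     = ⊥-elim (ℤₚ.<⇒≱ p<x x≤p)
... | yes _ | no _    | no ¬q | _     = ⊥-elim (¬q p<x)
... | yes _ | no _    | yes _ | no ¬q = ⊥-elim (¬q x≤)

T-skips : ∀ xs p L x → + (p + sum xs) ℤ.< x → T (p ∷ xs ++ L) x ≡ T ((p + sum xs) ∷ L) x
T-skips []       p L x _ rewrite ℕₚ.+-identityʳ p = refl
T-skips (a ∷ xs) p L x lt = begin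
  T (p ∷ a ∷ xs ++ L) x      ≡⟨ T-skip p a (xs ++ L) x (ℤₚ.≤-<-trans (+≤+ p+a≤) lt) ⟩
  T ((p + a) ∷ xs ++ L) x    ≡⟨ T-skips xs (p + a) L x (subst (λ s → + s ℤ.< x) (sym assoc) lt) ⟩
  T ((p + a + sum xs) ∷ L) x ≡⟨ cong (λ s → T (s ∷ L) x) assoc ⟩
  T ((p + (a + sum xs)) ∷ L) x ∎
  where
  open ≡-Reasoning
  assoc = ℕₚ.+-assoc p a (sum xs)
  p+a≤ = ℕₚ.+-monoʳ-≤ p (ℕₚ.m≤m+n a (sum xs))

T-block : ∀ xs a ys k → sum xs < k → k ≤ sum xs + a →
  T (xs ++ a ∷ ys) (+ k) ≡ + k ℤ.+ (+ sum ys ℤ.- + sum xs)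
T-block xs a ys k X<k k≤ = begin
  T (xs ++ a ∷ ys) (+ k)          ≡⟨ T-cons-zero (xs ++ a ∷ ys) (+ k) (+<+ (ℕₚ.≤-<-trans z≤n X<k)) ⟩
  T (0 ∷ xs ++ a ∷ ys) (+ k)      ≡⟨ T-skips xs 0 (a ∷ ys) (+ k) (+<+ X<k) ⟩
  T (sum xs ∷ a ∷ ys) (+ k)       ≡⟨ T-hit (sum xs) a ys (+ k) (+<+ X<k) (+≤+ k≤) ⟩
  + k ℤ.+ (+ sum ys ℤ.- + sum xs) ∎
  where open ≡-Reasoning

+a+[+b-+c]≡+d : c + d ≡ a + b → + a ℤ.+ (+ b ℤ.- + c) ≡ + d
+a+[+b-+c]≡+d {c} {d} {a} {b} e = begin
  + a ℤ.+ (+ b ℤ.- + c)  ≡⟨ assoc (+ a) (+ b) (+ c) ⟩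
  + a ℤ.+ + b ℤ.- + c    ≡⟨ cong (ℤ._- + c) (ℤₚ.pos-+ a b) ⟨
  + (a + b) ℤ.- + c      ≡⟨ +n-+m≡+d e ⟩
  + d                    ∎
  where
  open ≡-Reasoning
  assoc : ∀ i j k → i ℤ.+ (j ℤ.- k) ≡ i ℤ.+ j ℤ.- k
  assoc = ℤ-Solver.solve-∀

iter-two-cycle : ∀ (f : ℤ → ℤ) {x y} → f x ≡ y → f y ≡ x → ∀ k → iter f k x ≡ x ⊎ iter f k x ≡ y
iter-two-cycle f fx≡y fy≡x zero = inj₁ refl
iter-two-cycle f fx≡y fy≡x (suc k) with iter-two-cycle f fx≡y fy≡x k
... | inj₁ e = inj₂ (trans (cong f e) fx≡y)
... | inj₂ e = inj₁ (trans (cong f e) fy≡x)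

double-centre-swap : ∀ xs b ys → 0 < b → sum xs ≡ sum ys →
  T (xs ++ b ∷ b ∷ ys) (+ suc (sum xs)) ≡ + suc (sum xs + b) ×
  T (xs ++ b ∷ b ∷ ys) (+ suc (sum xs + b)) ≡ + suc (sum xs)
double-centre-swap xs b ys 0<b X≡Y = forth , back
  where
  open ≡-Reasoning
  X = sum xs
  X′ = sum (xs ∷ʳ b)
  X′≡X+b = sum-∷ʳ xs b
  forth-arith : ∀ x b → x + suc (x + b) ≡ suc x + (b + x)
  forth-arith = solve-∀
  back-arith : ∀ x b → x + b + suc x ≡ suc (x + b) + x
  back-arith = solve-∀
  forth : T (xs ++ b ∷ b ∷ ys) (+ suc X) ≡ + suc (X + b)
  forth = begin
    T (xs ++ b ∷ b ∷ ys) (+ suc X)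
      ≡⟨ T-block xs b (b ∷ ys) (suc X) (ℕₚ.n<1+n X) (ℕₚ.m<m+n X 0<b) ⟩
    + suc X ℤ.+ (+ (b + sum ys) ℤ.- + X)
      ≡⟨ +a+[+b-+c]≡+d (trans (forth-arith X b) (cong (λ y → suc X + (b + y)) X≡Y)) ⟩
    + suc (X + b) ∎
  back : T (xs ++ b ∷ b ∷ ys) (+ suc (X + b)) ≡ + suc X
  back = begin
    T (xs ++ b ∷ b ∷ ys) (+ suc (X + b))
      ≡⟨ cong (λ L → T L (+ suc (X + b))) (∷ʳ-++ xs b (b ∷ ys)) ⟨
    T ((xs ∷ʳ b) ++ b ∷ ys) (+ suc (X + b))
      ≡⟨ T-block (xs ∷ʳ b) b ys (suc (X + b))
           (subst (_< suc (X + b)) (sym X′≡X+b) (ℕₚ.n<1+n (X + b)))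
           (subst (λ s → suc (X + b) ≤ s + b) (sym X′≡X+b) (ℕₚ.m<m+n (X + b) 0<b)) ⟩
    + suc (X + b) ℤ.+ (+ sum ys ℤ.- + X′)
      ≡⟨ +a+[+b-+c]≡+d (trans (cong (λ s → s + suc X) X′≡X+b)
                              (trans (back-arith X b) (cong (λ y → suc (X + b) + y) X≡Y))) ⟩
    + suc X ∎

centre-in-range : ∀ xs b ys → 0 < b → InRange (sum (xs ++ b ∷ ys)) (+ suc (sum xs))
centre-in-range xs b ys 0<b =
  +≤+ (s≤s z≤n) ,
  +≤+ (subst (suc (sum xs) ≤_) (sym (sum-++ xs (b ∷ ys)))
        (ℕₚ.m<m+n (sum xs) (ℕₚ.<-≤-trans 0<b (ℕₚ.m≤m+n b (sum ys)))))

double-centre-orbit : ∀ xs b ys → 0 < b → sum xs ≡ sum ys → Circular (xs ++ b ∷ b ∷ ys) →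
  ∀ y → InRange (sum (xs ++ b ∷ b ∷ ys)) y → y ≡ + suc (sum xs) ⊎ y ≡ + suc (sum xs + b)
double-centre-orbit xs b ys 0<b X≡Y (_ , orbit) y y∈
  with orbit _ y (centre-in-range xs b (b ∷ ys) 0<b) y∈
... | k , refl = iter-two-cycle (T (xs ++ b ∷ b ∷ ys)) (proj₁ swap) (proj₂ swap) k
  where swap = double-centre-swap xs b ys 0<b X≡Y

circular-double⇒11 : ∀ xs b ys → IsComposition (xs ++ b ∷ b ∷ ys) → sum xs ≡ sum ys →
  Circular (xs ++ b ∷ b ∷ ys) → xs ++ b ∷ b ∷ ys ≡ 1 ∷ 1 ∷ []
circular-double⇒11 [] zero _ (() ∷ _) _ _
circular-double⇒11 [] 1 ys c X≡Y _ = cong (λ zs → 1 ∷ 1 ∷ zs) (sum≡0⇒[] (tail (tail c)) (sym X≡Y))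
circular-double⇒11 [] (suc (suc k)) ys c X≡Y circ
  with double-centre-orbit [] _ ys (s≤s z≤n) X≡Y circ (+ 2) (+≤+ (s≤s z≤n) , +≤+ (s≤s (s≤s z≤n)))
... | inj₁ ()
... | inj₂ ()
circular-double⇒11 (zero ∷ _) _ _ (() ∷ _) _ _
circular-double⇒11 (suc x ∷ xs) b ys c X≡Y circ
  with double-centre-orbit (suc x ∷ xs) b ys (part-positive {xs = suc x ∷ xs} c) X≡Y circ
         (+ 1) (+≤+ (s≤s z≤n) , +≤+ (s≤s z≤n))
... | inj₁ ()
... | inj₂ ()

UniqueParent : List ℕ → Set
UniqueParent L = Σ (List ℕ) λ μ → (IsComposition μ × IsChild μ L) ×
  ((ν : List ℕ) → IsComposition ν → IsChild ν L → ν ≡ μ)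

composition-remove : ∀ xs → IsComposition (xs ++ b ∷ ys) → IsComposition (xs ++ ys)
composition-remove xs c = ++⁺ (++⁻ˡ xs c) (tail (++⁻ʳ xs c))

composition-remove-next : ∀ xs → IsComposition (xs ++ b ∷ c ∷ ys) → IsComposition (xs ++ b ∷ ys)
composition-remove-next xs c = ++⁺ (++⁻ˡ xs c) (head (++⁻ʳ xs c) ∷ tail (tail (++⁻ʳ xs c)))

half⇒balanced : ∀ xs b c ys → 2 * (sum xs + b) ≡ sum (xs ++ b ∷ c ∷ ys) → sum xs + b ≡ c + sum ys
half⇒balanced xs b c ys half = ℕₚ.+-cancelˡ-≡ (sum xs + b) (sum xs + b) (c + sum ys) (begin
  sum xs + b + (sum xs + b)    ≡⟨ 2*n≡n+n (sum xs + b) ⟨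
  2 * (sum xs + b)             ≡⟨ half ⟩
  sum (xs ++ b ∷ c ∷ ys)       ≡⟨ sum-++ xs (b ∷ c ∷ ys) ⟩
  sum xs + (b + (c + sum ys))  ≡⟨ ℕₚ.+-assoc (sum xs) b (c + sum ys) ⟨
  sum xs + b + (c + sum ys)    ∎)
  where open ≡-Reasoning

straddling-unique-parent : IsComposition (xs ++ b ∷ ys) → Straddles (sum (xs ++ b ∷ ys)) xs b →
  UniqueParent (xs ++ b ∷ ys)
straddling-unique-parent {xs} {b} {ys} cL S =
  xs ++ (b ∸ gap (sum xs) (sum ys)) ∷ ys , straddling-parent cL S ,
  λ ν cν child → straddling-parent-unique cν child S

balanced-unique-parent : IsComposition (xs ++ b ∷ c ∷ ys) → Circular (xs ++ b ∷ c ∷ ys) →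
  xs ++ b ∷ c ∷ ys ≢ 1 ∷ 1 ∷ [] → sum xs + b ≡ c + sum ys → UniqueParent (xs ++ b ∷ c ∷ ys)
balanced-unique-parent {xs} {b} {c} {ys} cL circ L≢11 bal with ℕₚ.<-cmp b c
... | tri< b<c _ _ =
  xs ++ b ∷ ys ,
  (composition-remove-next xs cL , inj₂ (balanced-parent-left bal b<c)) ,
  λ ν cν child → [ (λ (_ , c<b) → ⊥-elim (ℕₚ.<-asym b<c c<b)) , proj₁ ]
                   (balanced-parent-unique cL bal cν child)
... | tri≈ _ refl _ =
  ⊥-elim (L≢11 (circular-double⇒11 xs b ys cL X≡Y circ))
  where X≡Y = ℕₚ.+-cancelˡ-≡ b (sum xs) (sum ys) (trans (ℕₚ.+-comm b (sum xs)) bal)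
... | tri> _ _ c<b =
  xs ++ c ∷ ys ,
  (composition-remove xs cL , inj₂ (balanced-parent-right bal c<b)) ,
  λ ν cν child → [ proj₁ , (λ (_ , b<c) → ⊥-elim (ℕₚ.<-asym b<c c<b)) ]
                   (balanced-parent-unique cL bal cν child)

corollary10 : (λ' : List ℕ) → IsComposition λ' → Circular λ' → ¬ (λ' ≡ 1 ∷ 1 ∷ []) →
    Σ (List ℕ) (λ μ → (IsComposition μ × IsChild μ λ') ×
    ((ν : List ℕ) → IsComposition ν → IsChild ν λ' → ν ≡ μ))
corollary10 L cL circ L≢11
  with locate L (sum L) (proj₁ circ)
         (subst (sum L <_) (sym (2*n≡n+n (sum L))) (ℕₚ.m<m+n (sum L) (proj₁ circ)))
... | inj₁ (xs , b , ys , refl , S) = straddling-unique-parent cL S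
... | inj₂ (xs , b , c , ys , refl , half) =
  balanced-unique-parent cL circ L≢11 (half⇒balanced xs b c ys half)
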